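{- Let $G$ and $H$ be two connected graphs with $G\neq K_1$ and $H\neq K_2$. (i) If $D(G)=1$, then $D'(G\circ H)\leqslant \min\{D'(H),|V(H)|\}$. (ii) If $|V(G)|\leqslant |V(H)|+1$ and $D'(H)=1$, then $D'(G\circ H)\leqslant 2$.
   Context: $K_1$, $K_2$ are the complete graphs on one and two vertices. The corona $G\circ H$ is obtained by taking one copy of $G$ and $|V(G)|$ copies of $H$ and joining the $i$-th vertex of $G$ to every vertex of the $i$-th copy of $H$. The distinguishing number $D(G)$ is the least $r$ such that some vertex labeling $V(G)\to\{1,\dots,r\}$ is preserved by no non-identity automorphism of $G$; the distinguishing index $D'(G)$ is the least $d$ such that some edge colouring $E(G)\to\{1,\dots,d\}$ (not necessarily proper) is preserved by no non-identity automorphism of $G$ (acting on edges). -}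

module Defs where

open import Data.Nat using (ℕ; zero; suc; _+_; _*_; _≤_; _<_)
open import Data.Fin using (Fin; splitAt; remQuot; _≟_)
open import Data.Fin.Permutation using (Permutation′; _⟨$⟩ʳ_)
open import Data.Bool using (Bool; true; false; _∧_)
open import Data.Sum using (_⊎_; inj₁; inj₂)
open import Data.Product using (_×_; _,_; ∃-syntax)
open import Relation.Nullary using (¬_)
open import Relation.Nullary.Decidable using (⌊_⌋)
open import Relation.Binary.PropositionalEquality using (_≡_; _≢_)

Graph : ℕ → Set
Graph n = Fin n → Fin n → Bool

Adj : ∀ {n} → Graph n → Fin n → Fin n → Set
Adj G u v = G u v ≡ true

IsSimple : ∀ {n} → Graph n → Set
IsSimple {n} G = (∀ u v → G u v ≡ G v u) × (∀ v → G v v ≡ false)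

data Reachable {n} (G : Graph n) : Fin n → Fin n → Set where
  here : ∀ {u} → Reachable G u u
  step : ∀ {u v w} → Adj G u v → Reachable G v w → Reachable G u w

Connected : ∀ {n} → Graph n → Set
Connected {n} G = (0 < n) × (∀ u v → Reachable G u v)

IsComplete : ∀ {n} → Graph n → Set
IsComplete {n} G = ∀ u v → u ≢ v → Adj G u v

IsAut : ∀ {n} → Graph n → Permutation′ n → Set
IsAut G π = ∀ u v → G (π ⟨$⟩ʳ u) (π ⟨$⟩ʳ v) ≡ G u v

IsIdentity : ∀ {n} → Permutation′ n → Set
IsIdentity π = ∀ v → π ⟨$⟩ʳ v ≡ v

-- vertex labelings with colours {1..r} (represented by Fin r)
VertexLabeling : ℕ → ℕ → Set
VertexLabeling n r = Fin n → Fin r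

IsDistinguishingLabeling : ∀ {n r} → Graph n → VertexLabeling n r → Set
IsDistinguishingLabeling G c =
  ∀ π → IsAut G π → (∀ v → c (π ⟨$⟩ʳ v) ≡ c v) → IsIdentity π

HasDistLabeling : ∀ {n} → Graph n → ℕ → Set
HasDistLabeling {n} G r = ∃[ c ] IsDistinguishingLabeling {n} {r} G c

DistNumberIs : ∀ {n} → Graph n → ℕ → Set
DistNumberIs G r = (1 ≤ r) × HasDistLabeling G r × (∀ s → 1 ≤ s → s < r → ¬ HasDistLabeling G s)

-- edge colourings with colours {1..d}: a colour for each ordered pair, required to be
-- symmetric on edges (values on non-edges are irrelevant)
EdgeColouring : ℕ → ℕ → Set
EdgeColouring n d = Fin n → Fin n → Fin d

IsEdgeColouring : ∀ {n d} → Graph n → EdgeColouring n d → Set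
IsEdgeColouring G c = ∀ u v → Adj G u v → c u v ≡ c v u

PreservesEdgeColouring : ∀ {n d} → Graph n → EdgeColouring n d → Permutation′ n → Set
PreservesEdgeColouring G c π = ∀ u v → Adj G u v → c (π ⟨$⟩ʳ u) (π ⟨$⟩ʳ v) ≡ c u v

IsDistinguishingEdgeColouring : ∀ {n d} → Graph n → EdgeColouring n d → Set
IsDistinguishingEdgeColouring G c =
  IsEdgeColouring G c × (∀ π → IsAut G π → PreservesEdgeColouring G c π → IsIdentity π)

HasDistEdgeColouring : ∀ {n} → Graph n → ℕ → Set
HasDistEdgeColouring {n} G d = ∃[ c ] IsDistinguishingEdgeColouring {n} {d} G c

DistIndexIs : ∀ {n} → Graph n → ℕ → Set
DistIndexIs G d = (1 ≤ d) × HasDistEdgeColouring G d × (∀ e → 1 ≤ e → e < d → ¬ HasDistEdgeColouring G e)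

-- Corona G ∘ H.  Vertices Fin (m + m * k): the first m are the vertices of G,
-- vertex  m + p  with remQuot k p = (i , a)  is vertex a of the i-th copy of H.
corona : ∀ {m k} → Graph m → Graph k → Graph (m + m * k)
corona {m} {k} G H x y with splitAt m x | splitAt m y
... | inj₁ i | inj₁ j = G i j
... | inj₁ i | inj₂ q with remQuot {m} k q
...   | (j , _) = ⌊ i ≟ j ⌋
corona {m} {k} G H x y | inj₂ p | inj₁ j with remQuot {m} k p
...   | (i , _) = ⌊ i ≟ j ⌋
corona {m} {k} G H x y | inj₂ p | inj₂ q with remQuot {m} k p | remQuot {m} k q
...   | (i , a) | (j , b) = ⌊ i ≟ j ⌋ ∧ H a b

-- In G ∘ H every leaf is dominated by its base vertex (its closed neighbourhood lies inside the
-- base vertex's), while no base vertex is dominated, since it sees both a neighbour in G and its own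
-- copy of H. So every automorphism of the corona maps base vertices to base vertices, through an
-- automorphism σ of G, and the copy at i onto the copy at σ i, through an automorphism ρᵢ of H.
-- (i) G is asymmetric, so σ is trivial; ρᵢ is then forced to be trivial either by colouring every
-- copy with a distinguishing colouring of H, or by giving the spoke to leaf a the colour a.
-- (ii) H is asymmetric, so every ρᵢ is trivial; the spoke from base i to leaf b gets colour 1
-- iff b < i, and these patterns tell the m ≤ k + 1 base vertices apart.
-- D′ is obtained as the least number of colours admitting a distinguishing colouring, which exists
-- constructively because that property is decidable by finite search.
module Submission where

open import Defs
open import Data.Nat using (ℕ; zero; suc; _+_; _*_; _≤_; _<_; _<?_; _⊓_; z≤n; s≤s)
open import Data.Nat.Properties using (≤-pred; ≤-trans; <-irrefl; <-cmp; <-≤-trans; ≮⇒≥; ⊓-glb; +-comm)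
open import Data.Fin using (Fin; zero; suc; toℕ; fromℕ<; punchIn; _≟_; _↑ˡ_; _↑ʳ_; splitAt; combine; remQuot)
open import Data.Fin.Properties using (any?; all?; punchInᵢ≢i; toℕ<n; toℕ-injective; toℕ-fromℕ<; splitAt-↑ˡ; splitAt-↑ʳ; remQuot-combine; combine-remQuot; join-splitAt; ↑ˡ-injective; ↑ʳ-injective; combine-injective)
open import Data.Fin.Permutation using (Permutation′; _⟨$⟩ʳ_; _⟨$⟩ˡ_; permutation; inverseˡ; inverseʳ; flip; _≈_)
open import Data.Vec using (Vec; []; _∷_; lookup; tabulate)
open import Data.Vec.Properties using (lookup∘tabulate)
open import Data.Bool using (true; false; _∧_; if_then_else_)
open import Data.Bool.Properties using (∧-conicalˡ; ∧-conicalʳ; T-≡) renaming (_≟_ to _≟ᵇ_)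
open import Data.Sum using (_⊎_; inj₁; inj₂)
open import Data.Product using (_×_; _,_; ∃; ∃₂; ∃-syntax; proj₁; proj₂)
open import Data.Empty using (⊥-elim)
open import Function using (_∘_; _∘′_; Equivalence)
open import Relation.Nullary using (¬_; Dec; yes; no; contradiction)
open import Relation.Nullary.Decidable using (⌊_⌋; toWitness; fromWitness; map′; ¬?; _→-dec_; _×-dec_; decidable-stable)
open import Relation.Unary using (Decidable)
open import Relation.Binary using (tri<; tri≈; tri>)
open import Relation.Binary.PropositionalEquality
open ≡-Reasoning

Searchable : Set → Set₁
Searchable A = ∀ {P : A → Set} → Decidable P → Dec (∃ P)

searchable-Vec : ∀ {A} → Searchable A → ∀ n → Searchable (Vec A n)
searchable-Vec search zero P? with P? []
... | yes p = yes ([] , p)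
... | no ¬p = no λ { ([] , p) → ¬p p }
searchable-Vec search (suc n) {P} P?
  with search (λ a → searchable-Vec search n (λ v → P? (a ∷ v)))
... | yes (a , v , p) = yes (a ∷ v , p)
... | no ¬p = no λ { (a ∷ v , p) → ¬p (a , v , p) }

searchable⇒all? : ∀ {A} → Searchable A → ∀ {P : A → Set} → Decidable P → Dec (∀ a → P a)
searchable⇒all? search P? with search (¬? ∘ P?)
... | yes (a , ¬p) = no λ all → ¬p (all a)
... | no ¬∃ = yes λ a → decidable-stable (P? a) (λ ¬p → ¬∃ (a , ¬p))

module _ {n : ℕ} where
  private
    InverseTables : Vec (Fin n) n → Vec (Fin n) n → Set
    InverseTables F G = (∀ y → lookup F (lookup G y) ≡ y) × (∀ x → lookup G (lookup F x) ≡ x)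

    fromTables : ∀ F G → InverseTables F G → Permutation′ n
    fromTables F G (l , r) = permutation (lookup F) (lookup G) l r

    lookup-tabulate-inverse : ∀ {f g : Fin n → Fin n} → (∀ y → f (g y) ≡ y) →
      ∀ y → lookup (tabulate f) (lookup (tabulate g) y) ≡ y
    lookup-tabulate-inverse {f} {g} fg y rewrite lookup∘tabulate g y | lookup∘tabulate f (g y) = fg y

    tables-inverse : ∀ (π : Permutation′ n) → InverseTables (tabulate (π ⟨$⟩ʳ_)) (tabulate (π ⟨$⟩ˡ_))
    tables-inverse π = lookup-tabulate-inverse (λ _ → inverseʳ π) , lookup-tabulate-inverse (λ _ → inverseˡ π)

  -- A permutation is searched for through the tables of its two directions.
  ∀-Permutation? : ∀ {Q : Permutation′ n → Set} →
    (∀ π ρ → π ≈ ρ → Q π → Q ρ) → Decidable Q → Dec (∀ π → Q π)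
  ∀-Permutation? {Q} resp Q? =
    map′ (λ h π → resp _ π (lookup∘tabulate (π ⟨$⟩ʳ_))
                    (h (tabulate (π ⟨$⟩ʳ_)) (tabulate (π ⟨$⟩ˡ_)) (tables-inverse π)))
         (λ h F G i → h (fromTables F G i))
         (searchable⇒all? tables λ F → searchable⇒all? tables λ G → onInverse? F G)
    where
    tables : Searchable (Vec (Fin n) n)
    tables = searchable-Vec any? n
    onInverse? : ∀ F G → Dec ((i : InverseTables F G) → Q (fromTables F G i))
    onInverse? F G with all? (λ y → lookup F (lookup G y) ≟ y) ×-dec all? (λ x → lookup G (lookup F x) ≟ x)
    ... | no ¬i = yes λ i → ⊥-elim (¬i i)
    ... | yes i = map′ (λ q _ → resp _ _ (λ _ → refl) q) (λ h → h i) (Q? (fromTables F G i))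

module _ {n : ℕ} (Γ : Graph n) where
  private
    Colouring-≗ : ∀ {d} → EdgeColouring n d → EdgeColouring n d → Set
    Colouring-≗ c c′ = ∀ u v → c u v ≡ c′ u v

  IsAut-resp : ∀ {π ρ} → π ≈ ρ → IsAut Γ π → IsAut Γ ρ
  IsAut-resp π≈ρ aut u v = subst₂ (λ x y → Γ x y ≡ Γ u v) (π≈ρ u) (π≈ρ v) (aut u v)

  Preserves-resp : ∀ {d} {c : EdgeColouring n d} {π ρ} → π ≈ ρ →
    PreservesEdgeColouring Γ c π → PreservesEdgeColouring Γ c ρ
  Preserves-resp {c = c} π≈ρ pres u v uv = subst₂ (λ x y → c x y ≡ c u v) (π≈ρ u) (π≈ρ v) (pres u v uv)

  IsDistinguishingEdgeColouring-resp : ∀ {d} {c c′ : EdgeColouring n d} → Colouring-≗ c c′ →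
    IsDistinguishingEdgeColouring Γ c → IsDistinguishingEdgeColouring Γ c′
  IsDistinguishingEdgeColouring-resp {c = c} {c′} c≗c′ (sym-c , dist) = sym-c′ , dist′
    where
    sym-c′ : IsEdgeColouring Γ c′
    sym-c′ u v uv = trans (sym (c≗c′ u v)) (trans (sym-c u v uv) (c≗c′ v u))
    dist′ : ∀ π → IsAut Γ π → PreservesEdgeColouring Γ c′ π → IsIdentity π
    dist′ π aut pres = dist π aut λ u v uv →
      trans (c≗c′ _ _) (trans (pres u v uv) (sym (c≗c′ u v)))

  adj? : ∀ u v → Dec (Adj Γ u v)
  adj? u v = Γ u v ≟ᵇ true

  isDistinguishingEdgeColouring? : ∀ {d} (c : EdgeColouring n d) → Dec (IsDistinguishingEdgeColouring Γ c)
  isDistinguishingEdgeColouring? c =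
    (all? λ u → all? λ v → adj? u v →-dec c u v ≟ c v u)
      ×-dec ∀-Permutation? ForcesIdentity-resp forcesIdentity?
    where
    ForcesIdentity : Permutation′ n → Set
    ForcesIdentity π = IsAut Γ π → PreservesEdgeColouring Γ c π → IsIdentity π
    ForcesIdentity-resp : ∀ π ρ → π ≈ ρ → ForcesIdentity π → ForcesIdentity ρ
    ForcesIdentity-resp π ρ π≈ρ dist aut pres v =
      trans (sym (π≈ρ v)) (dist (IsAut-resp {ρ} {π} ρ≈π aut) (Preserves-resp {c = c} {ρ} {π} ρ≈π pres) v)
      where
      ρ≈π : ρ ≈ π
      ρ≈π v = sym (π≈ρ v)
    forcesIdentity? : ∀ π → Dec (ForcesIdentity π)
    forcesIdentity? π =
      (all? λ u → all? λ v → Γ (π ⟨$⟩ʳ u) (π ⟨$⟩ʳ v) ≟ᵇ Γ u v) →-dec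
      (all? λ u → all? λ v → adj? u v →-dec c (π ⟨$⟩ʳ u) (π ⟨$⟩ʳ v) ≟ c u v) →-dec
      (all? λ v → π ⟨$⟩ʳ v ≟ v)

  hasDistEdgeColouring? : ∀ d → Dec (HasDistEdgeColouring Γ d)
  hasDistEdgeColouring? d =
    map′ (λ (T , dist) → fromTable T , dist)
         (λ (c , dist) → toTable c , IsDistinguishingEdgeColouring-resp (λ u v → sym (lookup-toTable c u v)) dist)
         (searchable-Vec (searchable-Vec any? n) n (isDistinguishingEdgeColouring? ∘ fromTable))
    where
    fromTable : Vec (Vec (Fin d) n) n → EdgeColouring n d
    fromTable T u v = lookup (lookup T u) v
    toTable : EdgeColouring n d → Vec (Vec (Fin d) n) n
    toTable c = tabulate (tabulate ∘ c)
    lookup-toTable : ∀ c → Colouring-≗ (fromTable (toTable c)) c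
    lookup-toTable c u v rewrite lookup∘tabulate (tabulate ∘ c) u = lookup∘tabulate (c u) v

least : ∀ {P : ℕ → Set} → Decidable P → ∀ {b} → P b → ∃[ d ] (d ≤ b × P d × (∀ {e} → e < d → ¬ P e))
least P? {b} p with P? 0
... | yes p₀ = 0 , z≤n , p₀ , λ ()
least P? {zero} p | no ¬p₀ = ⊥-elim (¬p₀ p)
least P? {suc b} p | no ¬p₀ with least (P? ∘ suc) p
... | d , d≤b , pd , none-below = suc d , s≤s d≤b , pd , λ { {zero} _ → ¬p₀ ; {suc e} (s≤s e<d) → none-below e<d }

distIndex-exists : ∀ {n} (Γ : Graph n) {b} → 1 ≤ b → HasDistEdgeColouring Γ b → ∃[ d ] (DistIndexIs Γ d × d ≤ b)
distIndex-exists Γ {suc b} _ has with least (hasDistEdgeColouring? Γ ∘ suc) has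
... | d , d≤b , pd , none-below = suc d , (s≤s z≤n , pd , λ { (suc e) _ (s≤s e<d) → none-below e<d }) , s≤s d≤b

distIndex-minimal : ∀ {n} {Γ : Graph n} {d b} → DistIndexIs Γ d → 1 ≤ b → HasDistEdgeColouring Γ b → d ≤ b
distIndex-minimal (_ , _ , none-below) 1≤b has = ≮⇒≥ λ b<d → none-below _ 1≤b b<d has

≟-true⇒≡ : ∀ {n} {i j : Fin n} → ⌊ i ≟ j ⌋ ≡ true → i ≡ j
≟-true⇒≡ {i = i} {j} = toWitness {a? = i ≟ j} ∘ Equivalence.from T-≡

≟-refl : ∀ {n} (i : Fin n) → ⌊ i ≟ i ⌋ ≡ true
≟-refl i = Equivalence.to T-≡ (fromWitness {a? = i ≟ i} refl)

module _ {n : ℕ} (Γ : Graph n) where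

  IsAut-flip : ∀ {π} → IsAut Γ π → IsAut Γ (flip π)
  IsAut-flip {π} aut u v = trans (sym (aut (π ⟨$⟩ˡ u) (π ⟨$⟩ˡ v))) (cong₂ Γ (inverseʳ π) (inverseʳ π))

  ClosedNbhd : Fin n → Fin n → Set
  ClosedNbhd x y = y ≡ x ⊎ Adj Γ x y

  Dominated : Fin n → Set
  Dominated x = ∃ λ y → y ≢ x × (∀ z → ClosedNbhd x z → ClosedNbhd y z)

  Dominated-aut : ∀ {π x} → IsAut Γ π → Dominated x → Dominated (π ⟨$⟩ʳ x)
  Dominated-aut {π} {x} aut (y , y≢x , N[x]⊆N[y]) = π ⟨$⟩ʳ y , πy≢πx , N[πx]⊆N[πy]
    where
    πy≢πx : π ⟨$⟩ʳ y ≢ π ⟨$⟩ʳ x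
    πy≢πx e = y≢x (trans (sym (inverseˡ π)) (trans (cong (π ⟨$⟩ˡ_) e) (inverseˡ π)))
    pull : ∀ {u z} → ClosedNbhd (π ⟨$⟩ʳ u) z → ClosedNbhd u (π ⟨$⟩ˡ z)
    pull (inj₁ refl) = inj₁ (inverseˡ π)
    pull {u} {z} (inj₂ adj) =
      inj₂ (trans (sym (aut u (π ⟨$⟩ˡ z))) (trans (cong (Γ (π ⟨$⟩ʳ u)) (inverseʳ π)) adj))
    push : ∀ {u z} → ClosedNbhd u (π ⟨$⟩ˡ z) → ClosedNbhd (π ⟨$⟩ʳ u) z
    push (inj₁ e) = inj₁ (trans (sym (inverseʳ π)) (cong (π ⟨$⟩ʳ_) e))
    push {u} {z} (inj₂ adj) =
      inj₂ (trans (cong (Γ (π ⟨$⟩ʳ u)) (sym (inverseʳ π))) (trans (aut u (π ⟨$⟩ˡ z)) adj))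
    N[πx]⊆N[πy] : ∀ z → ClosedNbhd (π ⟨$⟩ʳ x) z → ClosedNbhd (π ⟨$⟩ʳ y) z
    N[πx]⊆N[πy] z = push ∘′ N[x]⊆N[y] (π ⟨$⟩ˡ z) ∘′ pull

  Dominated-aut⁻¹ : ∀ {π x} → IsAut Γ π → Dominated (π ⟨$⟩ʳ x) → Dominated x
  Dominated-aut⁻¹ {π} aut dom = subst Dominated (inverseˡ π) (Dominated-aut {flip π} (IsAut-flip {π} aut) dom)

Asymmetric : ∀ {n} → Graph n → Set
Asymmetric G = ∀ π → IsAut G π → IsIdentity π

below : ℕ → ℕ → Fin 2
below x y = if ⌊ x <? y ⌋ then suc zero else zero

below-irrefl : ∀ x → below x x ≡ zero
below-irrefl x with x <? x
... | yes x<x = contradiction x<x (<-irrefl refl)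
... | no _ = refl

below-< : ∀ {x y} → x < y → below x y ≡ suc zero
below-< {x} {y} x<y with x <? y
... | yes _ = refl
... | no x≮y = contradiction x<y x≮y

-- b = x is a threshold below y but not below x.
below-separates : ∀ {k x y} → x < y → y ≤ k → ∃ λ (b : Fin k) → below (toℕ b) x ≢ below (toℕ b) y
below-separates {k} {x} {y} x<y y≤k =
  fromℕ< x<k , subst (λ t → below t x ≢ below t y) (sym (toℕ-fromℕ< x<k)) x-splits
  where
  x<k : x < k
  x<k = <-≤-trans x<y y≤k
  x-splits : below x x ≢ below x y
  x-splits e with () ← trans (sym (below-irrefl x)) (trans e (below-< x<y))

below-injective : ∀ {k x y} → x ≤ k → y ≤ k → (∀ (b : Fin k) → below (toℕ b) x ≡ below (toℕ b) y) → x ≡ y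
below-injective {k} {x} {y} x≤k y≤k same with <-cmp x y
... | tri≈ _ x≡y _ = x≡y
... | tri< x<y _ _ = let b , differ = below-separates x<y y≤k in contradiction (same b) differ
... | tri> _ _ y<x = let b , differ = below-separates y<x x≤k in contradiction (sym (same b)) differ

module Corona {m k : ℕ} (G : Graph m) (H : Graph k) where

  Γ : Graph (m + m * k)
  Γ = corona G H

  base : Fin m → Fin (m + m * k)
  base i = i ↑ˡ (m * k)

  leaf : Fin m → Fin k → Fin (m + m * k)
  leaf i a = m ↑ʳ combine i a

  data View : Fin (m + m * k) → Set where
    base-view : ∀ i → View (base i)
    leaf-view : ∀ i a → View (leaf i a)

  view : ∀ x → View x
  view x with splitAt m x | join-splitAt m (m * k) x
  ... | inj₁ i | refl = base-view i
  ... | inj₂ p | refl = subst (λ q → View (m ↑ʳ q)) (combine-remQuot {m} k p) (leaf-view _ _)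

  base-injective : ∀ {i j} → base i ≡ base j → i ≡ j
  base-injective = ↑ˡ-injective (m * k) _ _

  leaf-injective : ∀ {i a j b} → leaf i a ≡ leaf j b → i ≡ j × a ≡ b
  leaf-injective e = combine-injective _ _ _ _ (↑ʳ-injective m _ _ e)

  base≢leaf : ∀ {i j b} → base i ≢ leaf j b
  base≢leaf {i} {j} {b} e
    with () ← trans (sym (splitAt-↑ˡ m i (m * k))) (trans (cong (splitAt m) e) (splitAt-↑ʳ m (m * k) (combine j b)))

  copy-of : ∀ i a → proj₁ (remQuot {m} k (combine i a)) ≡ i
  copy-of i a = cong proj₁ (remQuot-combine {m} {k} i a)

  vertex-of : ∀ i a → proj₂ (remQuot {m} k (combine i a)) ≡ a
  vertex-of i a = cong proj₂ (remQuot-combine {m} {k} i a)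

  Γ-base-base : ∀ i j → Γ (base i) (base j) ≡ G i j
  Γ-base-base i j rewrite splitAt-↑ˡ m i (m * k) | splitAt-↑ˡ m j (m * k) = refl

  Γ-base-leaf : ∀ i j b → Γ (base i) (leaf j b) ≡ ⌊ i ≟ j ⌋
  Γ-base-leaf i j b rewrite splitAt-↑ˡ m i (m * k) | splitAt-↑ʳ m (m * k) (combine j b)
    | copy-of j b = refl

  Γ-leaf-base : ∀ i a j → Γ (leaf i a) (base j) ≡ ⌊ i ≟ j ⌋
  Γ-leaf-base i a j rewrite splitAt-↑ʳ m (m * k) (combine i a) | splitAt-↑ˡ m j (m * k)
    | copy-of i a = refl

  Γ-leaf-leaf : ∀ i a j b → Γ (leaf i a) (leaf j b) ≡ ⌊ i ≟ j ⌋ ∧ H a b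
  Γ-leaf-leaf i a j b rewrite splitAt-↑ʳ m (m * k) (combine i a) | splitAt-↑ʳ m (m * k) (combine j b)
    | copy-of i a | copy-of j b | vertex-of i a | vertex-of j b = refl

  Γ-same-copy : ∀ i a b → Γ (leaf i a) (leaf i b) ≡ H a b
  Γ-same-copy i a b = trans (Γ-leaf-leaf i a i b) (cong (_∧ H a b) (≟-refl i))

  spoke : ∀ i a → Adj Γ (base i) (leaf i a)
  spoke i a = trans (Γ-base-leaf i i a) (≟-refl i)

  adj-base-leaf : ∀ {i j b} → Adj Γ (base i) (leaf j b) → i ≡ j
  adj-base-leaf {i} {j} {b} adj = ≟-true⇒≡ (trans (sym (Γ-base-leaf i j b)) adj)

  adj-leaf-base : ∀ {i a j} → Adj Γ (leaf i a) (base j) → i ≡ j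
  adj-leaf-base {i} {a} {j} adj = ≟-true⇒≡ (trans (sym (Γ-leaf-base i a j)) adj)

  adj-leaf-leaf : ∀ {i a j b} → Adj Γ (leaf i a) (leaf j b) → i ≡ j × Adj H a b
  adj-leaf-leaf {i} {a} {j} {b} adj =
    ≟-true⇒≡ (∧-conicalˡ _ _ adj′) , ∧-conicalʳ _ _ adj′
    where
    adj′ : ⌊ i ≟ j ⌋ ∧ H a b ≡ true
    adj′ = trans (sym (Γ-leaf-leaf i a j b)) adj

  leaf-dominated : ∀ i a → Dominated Γ (leaf i a)
  leaf-dominated i a = base i , base≢leaf , N[leaf]⊆N[base]
    where
    N[leaf]⊆N[base] : ∀ z → ClosedNbhd Γ (leaf i a) z → ClosedNbhd Γ (base i) z
    N[leaf]⊆N[base] z (inj₁ refl) = inj₂ (spoke i a)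
    N[leaf]⊆N[base] z (inj₂ adj) with view z
    ... | base-view j with refl ← adj-leaf-base adj = inj₁ refl
    ... | leaf-view j b with refl , _ ← adj-leaf-leaf adj = inj₂ (spoke i b)

  coronaColouring : ∀ {d} → Fin d → (Fin m → Fin k → Fin d) → EdgeColouring k d → EdgeColouring (m + m * k) d
  coronaColouring onG onSpoke onCopy x y with splitAt m x | splitAt m y
  ... | inj₁ _ | inj₁ _ = onG
  ... | inj₁ i | inj₂ q = onSpoke i (proj₂ (remQuot {m} k q))
  ... | inj₂ p | inj₁ j = onSpoke j (proj₂ (remQuot {m} k p))
  ... | inj₂ p | inj₂ q = onCopy (proj₂ (remQuot {m} k p)) (proj₂ (remQuot {m} k q))

  module _ {d} (onG : Fin d) (onSpoke : Fin m → Fin k → Fin d) (onCopy : EdgeColouring k d) where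
    private
      c : EdgeColouring (m + m * k) d
      c = coronaColouring onG onSpoke onCopy

    coronaColouring-base-base : ∀ i j → c (base i) (base j) ≡ onG
    coronaColouring-base-base i j rewrite splitAt-↑ˡ m i (m * k) | splitAt-↑ˡ m j (m * k) = refl

    coronaColouring-base-leaf : ∀ i j b → c (base i) (leaf j b) ≡ onSpoke i b
    coronaColouring-base-leaf i j b rewrite splitAt-↑ˡ m i (m * k) | splitAt-↑ʳ m (m * k) (combine j b)
      | vertex-of j b = refl

    coronaColouring-leaf-base : ∀ i a j → c (leaf i a) (base j) ≡ onSpoke j a
    coronaColouring-leaf-base i a j rewrite splitAt-↑ʳ m (m * k) (combine i a) | splitAt-↑ˡ m j (m * k)
      | vertex-of i a = refl

    coronaColouring-leaf-leaf : ∀ i a j b → c (leaf i a) (leaf j b) ≡ onCopy a b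
    coronaColouring-leaf-leaf i a j b rewrite splitAt-↑ʳ m (m * k) (combine i a) | splitAt-↑ʳ m (m * k) (combine j b)
      | vertex-of i a | vertex-of j b = refl

    coronaColouring-isEdgeColouring : IsEdgeColouring H onCopy → IsEdgeColouring Γ c
    coronaColouring-isEdgeColouring onCopy-sym x y adj with view x | view y
    ... | base-view i | base-view j =
      trans (coronaColouring-base-base i j) (sym (coronaColouring-base-base j i))
    ... | base-view i | leaf-view j b =
      trans (coronaColouring-base-leaf i j b) (sym (coronaColouring-leaf-base j b i))
    ... | leaf-view i a | base-view j =
      trans (coronaColouring-leaf-base i a j) (sym (coronaColouring-base-leaf j i a))
    ... | leaf-view i a | leaf-view j b = begin
      c (leaf i a) (leaf j b)   ≡⟨ coronaColouring-leaf-leaf i a j b ⟩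
      onCopy a b                ≡⟨ onCopy-sym a b (proj₂ (adj-leaf-leaf adj)) ⟩
      onCopy b a                ≡⟨ coronaColouring-leaf-leaf j b i a ⟨
      c (leaf j b) (leaf i a)   ∎

  module Automorphisms (loopless : ∀ i → G i i ≡ false) (neighbour : ∀ i → ∃ (Adj G i)) (a₀ : Fin k) where

    adj⇒≢ : ∀ {i j} → Adj G i j → i ≢ j
    adj⇒≢ {i} ij refl = contradiction (trans (sym (loopless i)) ij) λ ()

    same-copy : ∀ {i a j b} → ClosedNbhd Γ (leaf j b) (leaf i a) → j ≡ i
    same-copy (inj₁ e) = sym (proj₁ (leaf-injective e))
    same-copy (inj₂ adj) = proj₁ (adj-leaf-leaf adj)

    -- A base vertex has a neighbour in G and one in its own copy of H; no other vertex sees both.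
    base-undominated : ∀ i → ¬ Dominated Γ (base i)
    base-undominated i (y , y≢base , N[base]⊆N[y]) with view y | N[base]⊆N[y] (leaf i a₀) (inj₂ (spoke i a₀))
    ... | base-view j | inj₁ e = base≢leaf (sym e)
    ... | base-view j | inj₂ adj with refl ← adj-base-leaf adj = y≢base refl
    ... | leaf-view j b | sees-leaf with neighbour i
    ...   | g , ig with N[base]⊆N[y] (base g) (inj₂ (trans (Γ-base-base i g) ig))
    ...     | inj₁ e = base≢leaf e
    ...     | inj₂ adj = adj⇒≢ ig (trans (sym (same-copy sees-leaf)) (adj-leaf-base adj))

    undominated⇒base : ∀ x → ¬ Dominated Γ x → ∃ λ j → x ≡ base j
    undominated⇒base x ¬dom with view x
    ... | base-view j = j , refl
    ... | leaf-view j b = contradiction (leaf-dominated j b) ¬dom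

    dominated⇒leaf : ∀ x → Dominated Γ x → ∃₂ λ j b → x ≡ leaf j b
    dominated⇒leaf x dom with view x
    ... | base-view j = contradiction dom (base-undominated j)
    ... | leaf-view j b = j , b , refl

    module Automorphism (π : Permutation′ (m + m * k)) (aut : IsAut Γ π) where

      base-image : ∀ i → ∃ λ j → π ⟨$⟩ʳ base i ≡ base j
      base-image i = undominated⇒base _ (base-undominated i ∘ Dominated-aut⁻¹ Γ {π} aut)

      leaf-image : ∀ i a → ∃₂ λ j b → π ⟨$⟩ʳ leaf i a ≡ leaf j b
      leaf-image i a = dominated⇒leaf _ (Dominated-aut Γ {π} aut (leaf-dominated i a))

      σ : Fin m → Fin m
      σ i = proj₁ (base-image i)

      π-base : ∀ i → π ⟨$⟩ʳ base i ≡ base (σ i)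
      π-base i = proj₂ (base-image i)

      ρ : Fin m → Fin k → Fin k
      ρ i a = proj₁ (proj₂ (leaf-image i a))

      -- The spoke from base i to leaf a is mapped to an edge, so leaf a lands in the copy at σ i.
      π-leaf : ∀ i a → π ⟨$⟩ʳ leaf i a ≡ leaf (σ i) (ρ i a)
      π-leaf i a with leaf-image i a
      ... | j , b , e
        with refl ← adj-base-leaf (subst₂ (Adj Γ) (π-base i) e (trans (aut (base i) (leaf i a)) (spoke i a)))
        = e

      σ-aut : ∀ i j → G (σ i) (σ j) ≡ G i j
      σ-aut i j = begin
        G (σ i) (σ j)                        ≡⟨ Γ-base-base (σ i) (σ j) ⟨
        Γ (base (σ i)) (base (σ j))          ≡⟨ cong₂ Γ (π-base i) (π-base j) ⟨
        Γ (π ⟨$⟩ʳ base i) (π ⟨$⟩ʳ base j)    ≡⟨ aut (base i) (base j) ⟩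
        Γ (base i) (base j)                  ≡⟨ Γ-base-base i j ⟩
        G i j                                ∎

      ρ-aut : ∀ i a b → H (ρ i a) (ρ i b) ≡ H a b
      ρ-aut i a b = begin
        H (ρ i a) (ρ i b)                           ≡⟨ Γ-same-copy (σ i) (ρ i a) (ρ i b) ⟨
        Γ (leaf (σ i) (ρ i a)) (leaf (σ i) (ρ i b)) ≡⟨ cong₂ Γ (π-leaf i a) (π-leaf i b) ⟨
        Γ (π ⟨$⟩ʳ leaf i a) (π ⟨$⟩ʳ leaf i b)       ≡⟨ aut (leaf i a) (leaf i b) ⟩
        Γ (leaf i a) (leaf i b)                     ≡⟨ Γ-same-copy i a b ⟩
        H a b                                       ∎

      module _ {d} {onG : Fin d} {onSpoke : Fin m → Fin k → Fin d} {onCopy : EdgeColouring k d}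
               (pres : PreservesEdgeColouring Γ (coronaColouring onG onSpoke onCopy) π) where
        private
          c : EdgeColouring (m + m * k) d
          c = coronaColouring onG onSpoke onCopy

        onSpoke-preserved : ∀ i a → onSpoke (σ i) (ρ i a) ≡ onSpoke i a
        onSpoke-preserved i a = begin
          onSpoke (σ i) (ρ i a)                 ≡⟨ coronaColouring-base-leaf onG onSpoke onCopy (σ i) (σ i) (ρ i a) ⟨
          c (base (σ i)) (leaf (σ i) (ρ i a))   ≡⟨ cong₂ c (π-base i) (π-leaf i a) ⟨
          c (π ⟨$⟩ʳ base i) (π ⟨$⟩ʳ leaf i a)   ≡⟨ pres (base i) (leaf i a) (spoke i a) ⟩
          c (base i) (leaf i a)                 ≡⟨ coronaColouring-base-leaf onG onSpoke onCopy i i a ⟩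
          onSpoke i a                           ∎

        onCopy-preserved : ∀ i a b → Adj H a b → onCopy (ρ i a) (ρ i b) ≡ onCopy a b
        onCopy-preserved i a b ab = begin
          onCopy (ρ i a) (ρ i b)                        ≡⟨ coronaColouring-leaf-leaf onG onSpoke onCopy (σ i) (ρ i a) (σ i) (ρ i b) ⟨
          c (leaf (σ i) (ρ i a)) (leaf (σ i) (ρ i b))   ≡⟨ cong₂ c (π-leaf i a) (π-leaf i b) ⟨
          c (π ⟨$⟩ʳ leaf i a) (π ⟨$⟩ʳ leaf i b)         ≡⟨ pres (leaf i a) (leaf i b) (trans (Γ-same-copy i a b) ab) ⟩
          c (leaf i a) (leaf i b)                       ≡⟨ coronaColouring-leaf-leaf onG onSpoke onCopy i a i b ⟩
          onCopy a b                                    ∎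

      identity-criterion : (∀ i → σ i ≡ i) → (∀ i a → ρ i a ≡ a) → IsIdentity π
      identity-criterion σ≗id ρ≗id x with view x
      ... | base-view i = trans (π-base i) (cong base (σ≗id i))
      ... | leaf-view i a = trans (π-leaf i a) (cong₂ leaf (σ≗id i) (ρ≗id i a))

    module _ (π : Permutation′ (m + m * k)) (aut : IsAut Γ π) where
      private
        module A = Automorphism π aut
        module A⁻¹ = Automorphism (flip π) (IsAut-flip Γ {π} aut)

        σ∘σ⁻¹ : ∀ i → A.σ (A⁻¹.σ i) ≡ i
        σ∘σ⁻¹ i = base-injective (begin
          base (A.σ (A⁻¹.σ i))        ≡⟨ A.π-base (A⁻¹.σ i) ⟨
          π ⟨$⟩ʳ base (A⁻¹.σ i)       ≡⟨ cong (π ⟨$⟩ʳ_) (A⁻¹.π-base i) ⟨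
          π ⟨$⟩ʳ (π ⟨$⟩ˡ base i)      ≡⟨ inverseʳ π ⟩
          base i                      ∎)

        σ⁻¹∘σ : ∀ i → A⁻¹.σ (A.σ i) ≡ i
        σ⁻¹∘σ i = base-injective (begin
          base (A⁻¹.σ (A.σ i))        ≡⟨ A⁻¹.π-base (A.σ i) ⟨
          π ⟨$⟩ˡ base (A.σ i)         ≡⟨ cong (π ⟨$⟩ˡ_) (A.π-base i) ⟨
          π ⟨$⟩ˡ (π ⟨$⟩ʳ base i)      ≡⟨ inverseˡ π ⟩
          base i                      ∎)

        ρ⁻¹ : Fin m → Fin k → Fin k
        ρ⁻¹ i = A⁻¹.ρ (A.σ i)

        ρ⁻¹∘ρ : ∀ i a → ρ⁻¹ i (A.ρ i a) ≡ a
        ρ⁻¹∘ρ i a = sym (proj₂ (leaf-injective (begin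
          leaf i a                                  ≡⟨ inverseˡ π ⟨
          π ⟨$⟩ˡ (π ⟨$⟩ʳ leaf i a)                  ≡⟨ cong (π ⟨$⟩ˡ_) (A.π-leaf i a) ⟩
          π ⟨$⟩ˡ leaf (A.σ i) (A.ρ i a)             ≡⟨ A⁻¹.π-leaf (A.σ i) (A.ρ i a) ⟩
          leaf (A⁻¹.σ (A.σ i)) (ρ⁻¹ i (A.ρ i a))    ∎)))

        ρ∘ρ⁻¹ : ∀ i b → A.ρ i (ρ⁻¹ i b) ≡ b
        ρ∘ρ⁻¹ i b = subst (λ j → A.ρ j (ρ⁻¹ i b) ≡ b) (σ⁻¹∘σ i) (sym (proj₂ (leaf-injective (begin
          leaf (A.σ i) b                                   ≡⟨ inverseʳ π ⟨
          π ⟨$⟩ʳ (π ⟨$⟩ˡ leaf (A.σ i) b)                   ≡⟨ cong (π ⟨$⟩ʳ_) (A⁻¹.π-leaf (A.σ i) b) ⟩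
          π ⟨$⟩ʳ leaf (A⁻¹.σ (A.σ i)) (ρ⁻¹ i b)            ≡⟨ A.π-leaf (A⁻¹.σ (A.σ i)) (ρ⁻¹ i b) ⟩
          leaf (A.σ (A⁻¹.σ (A.σ i))) (A.ρ (A⁻¹.σ (A.σ i)) (ρ⁻¹ i b)) ∎))))

      base-permutation : Permutation′ m
      base-permutation = permutation A.σ A⁻¹.σ σ∘σ⁻¹ σ⁻¹∘σ

      copy-permutation : Fin m → Permutation′ k
      copy-permutation i = permutation (A.ρ i) (ρ⁻¹ i) (ρ∘ρ⁻¹ i) (ρ⁻¹∘ρ i)

    module _ (asymG : Asymmetric G) where

      base-fixed : ∀ π (aut : IsAut Γ π) → ∀ i → Automorphism.σ π aut i ≡ i
      base-fixed π aut = asymG (base-permutation π aut) (Automorphism.σ-aut π aut)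

      copyColouring-distinguishing : ∀ {d} {cH : EdgeColouring k d} → IsDistinguishingEdgeColouring H cH →
        IsDistinguishingEdgeColouring Γ (coronaColouring (cH a₀ a₀) (λ _ _ → cH a₀ a₀) cH)
      copyColouring-distinguishing (cH-sym , cH-dist) =
        coronaColouring-isEdgeColouring _ _ _ cH-sym ,
        λ π aut pres → let open Automorphism π aut in
          identity-criterion (base-fixed π aut) λ i →
            cH-dist (copy-permutation π aut i) (ρ-aut i) (onCopy-preserved pres i)

      leafColouring-distinguishing :
        IsDistinguishingEdgeColouring Γ (coronaColouring a₀ (λ _ a → a) (λ _ _ → a₀))
      leafColouring-distinguishing =
        coronaColouring-isEdgeColouring _ _ _ (λ _ _ _ → refl) ,
        λ π aut pres → let open Automorphism π aut in
          identity-criterion (base-fixed π aut) (onSpoke-preserved pres)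

    thresholdColouring-distinguishing : Asymmetric H → m ≤ suc k →
      IsDistinguishingEdgeColouring Γ (coronaColouring zero (λ i b → below (toℕ b) (toℕ i)) (λ _ _ → zero))
    thresholdColouring-distinguishing asymH m≤1+k =
      coronaColouring-isEdgeColouring _ _ _ (λ _ _ _ → refl) , distinguishes
      where
      index≤k : (i : Fin m) → toℕ i ≤ k
      index≤k i = ≤-pred (≤-trans (toℕ<n i) m≤1+k)

      distinguishes : ∀ π → IsAut Γ π →
        PreservesEdgeColouring Γ (coronaColouring zero (λ i b → below (toℕ b) (toℕ i)) (λ _ _ → zero)) π →
        IsIdentity π
      distinguishes π aut pres = identity-criterion σ-fixed ρ-fixed
        where
        open Automorphism π aut
        ρ-fixed : ∀ i a → ρ i a ≡ a
        ρ-fixed i = asymH (copy-permutation π aut i) (ρ-aut i)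
        σ-fixed : ∀ i → σ i ≡ i
        σ-fixed i = toℕ-injective (below-injective (index≤k (σ i)) (index≤k i) λ b → begin
          below (toℕ b) (toℕ (σ i))         ≡⟨ cong (λ b′ → below (toℕ b′) (toℕ (σ i))) (ρ-fixed i b) ⟨
          below (toℕ (ρ i b)) (toℕ (σ i))   ≡⟨ onSpoke-preserved pres i b ⟩
          below (toℕ b) (toℕ i)             ∎)

Fin1-irrelevant : (i j : Fin 1) → i ≡ j
Fin1-irrelevant zero zero = refl

distNumber-1⇒asymmetric : ∀ {n} {G : Graph n} → DistNumberIs G 1 → Asymmetric G
distNumber-1⇒asymmetric (_ , (_ , dist) , _) π aut = dist π aut λ v → Fin1-irrelevant _ _

distIndex-1⇒asymmetric : ∀ {n} {G : Graph n} → DistIndexIs G 1 → Asymmetric G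
distIndex-1⇒asymmetric (_ , (_ , _ , dist) , _) π aut = dist π aut λ u v _ → Fin1-irrelevant _ _

reachable⇒neighbour : ∀ {n} {G : Graph n} {i j} → Reachable G i j → i ≢ j → ∃ (Adj G i)
reachable⇒neighbour here i≢i = contradiction refl i≢i
reachable⇒neighbour (step ij _) _ = _ , ij

connected⇒neighbour : ∀ {n} {G : Graph n} → Connected G → ¬ n ≡ 1 → ∀ i → ∃ (Adj G i)
connected⇒neighbour {suc zero} _ n≢1 _ = contradiction refl n≢1
connected⇒neighbour {suc (suc n)} (_ , reach) _ i =
  reachable⇒neighbour (reach i (punchIn i zero)) (punchInᵢ≢i i zero ∘ sym)

mainTheorem17 : ∀ {m k} (G : Graph m) (H : Graph k) →
    IsSimple G → IsSimple H → Connected G → Connected H →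
    ¬ (m ≡ 1) → ¬ (k ≡ 2 × IsComplete H) →
    (DistNumberIs G 1 →
      ∀ dH → DistIndexIs H dH → ∃[ d ] (DistIndexIs (corona G H) d × d ≤ dH ⊓ k))
    × (m ≤ k + 1 → DistIndexIs H 1 → ∃[ d ] (DistIndexIs (corona G H) d × d ≤ 2))
mainTheorem17 {m} {k} G H (_ , loopless) _ G-connected (0<k , _) m≢1 _ = part-i , part-ii
  where
  open Corona G H
  open Automorphisms loopless (connected⇒neighbour G-connected m≢1) (fromℕ< 0<k)

  part-i : DistNumberIs G 1 → ∀ dH → DistIndexIs H dH → ∃[ d ] (DistIndexIs Γ d × d ≤ dH ⊓ k)
  part-i D[G]≡1 dH (1≤dH , (_ , cH-distinguishing) , _) =
    let asymG = distNumber-1⇒asymmetric D[G]≡1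
        d , D′≡d , d≤dH = distIndex-exists Γ 1≤dH (_ , copyColouring-distinguishing asymG cH-distinguishing)
    in d , D′≡d , ⊓-glb d≤dH (distIndex-minimal D′≡d 0<k (_ , leafColouring-distinguishing asymG))

  part-ii : m ≤ k + 1 → DistIndexIs H 1 → ∃[ d ] (DistIndexIs Γ d × d ≤ 2)
  part-ii m≤k+1 D′[H]≡1 = distIndex-exists Γ (s≤s z≤n)
    (_ , thresholdColouring-distinguishing (distIndex-1⇒asymmetric D′[H]≡1) (subst (m ≤_) (+-comm k 1) m≤k+1))
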